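{- Let $H$ be a finite graph. If the signature system of $H$ has an integer solution, then $\chi(H)\ge 4$.
   Context: $A(H)$ is the set of arcs of $H$ (each edge $[u,v]$ gives arcs $(u,v),(v,u)$). $\theta$ is the subgroup of $\mathbb{Z}^{A(H)}$ generated by the elements $(u,v)-(w,v)+(w,x)-(u,x)$ over all 4-cycles $u,v,w,x$ of $H$, and $\mathcal{G}(H)=\mathbb{Z}^{A(H)}/\theta$. The signature system of $H$ has an integer variable $X_{u,v}$ for each $(u,v)\in A(H)$ and an integer variable $N$, with constraints: $\sum_{v\in N_H(u)}(X_{u,v}-X_{v,u})=0$ for every vertex $u$ (flow); $\sum_{(u,v)\in A(H)}X_{u,v}-2N=1$ (parity); $\sum_{(u,v)\in A(H)}(X_{u,v}-X_{v,u})\cdot(u,v)\in\theta$, i.e. equal to $0$ in $\mathcal{G}(H)$ (signature). -}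

module Defs where

open import Data.Nat using (ℕ; zero; suc; _<_)
open import Data.Fin using (Fin; zero; suc)
open import Data.Fin.Properties using () renaming (_≟_ to _≟ᶠ_)
open import Data.Bool using (Bool; true; false; if_then_else_)
open import Data.Integer using (ℤ; 0ℤ; 1ℤ; _+_; _-_; _*_)
open import Data.List using (List; []; _∷_)
open import Data.Product using (Σ; _×_; _,_; ∃)
open import Relation.Binary.PropositionalEquality using (_≡_; _≢_)
open import Relation.Nullary using (¬_; yes; no)

record Graph (n : ℕ) : Set where
  field
    adj   : Fin n → Fin n → Bool
    sym   : ∀ u v → adj u v ≡ adj v u
    irrefl : ∀ u → adj u u ≡ false
open Graph public

∑ : ∀ {n} → (Fin n → ℤ) → ℤ
∑ {zero}  f = 0ℤ
∑ {suc n} f = f zero + ∑ (λ i → f (suc i))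

-- An element of ℤ^{A(H)} is represented by a function on all ordered pairs;
-- only its values on arcs (adj u v ≡ true) are meaningful.
ArcVec : ℕ → Set
ArcVec n = Fin n → Fin n → ℤ

_≈A_ : ∀ {n} {H : Graph n} → ArcVec n → ArcVec n → Set
_≈A_ {n} {H} f g = ∀ u v → adj H u v ≡ true → f u v ≡ g u v

δ : ∀ {n} → Fin n → Fin n → ArcVec n
δ a b p q with a ≟ᶠ p | b ≟ᶠ q
... | yes _ | yes _ = 1ℤ
... | _     | _     = 0ℤ

record FourCycle {n} (H : Graph n) : Set where
  field
    u v w x : Fin n
    u≢v : u ≢ v
    u≢w : u ≢ w
    u≢x : u ≢ x
    v≢w : v ≢ w
    v≢x : v ≢ x
    w≢x : w ≢ x
    uv : adj H u v ≡ true
    vw : adj H v w ≡ true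
    wx : adj H w x ≡ true
    xu : adj H x u ≡ true

gen : ∀ {n} {H : Graph n} → FourCycle H → ArcVec n
gen c p q = ((δ u v p q - δ w v p q) + δ w x p q) - δ u x p q
  where open FourCycle c

comb : ∀ {n} {H : Graph n} → List (ℤ × FourCycle H) → ArcVec n
comb []            p q = 0ℤ
comb ((k , c) ∷ l) p q = k * gen c p q + comb l p q

_∈θ_ : ∀ {n} (f : ArcVec n) (H : Graph n) → Set
f ∈θ H = ∃ λ (l : List (ℤ × FourCycle H)) → _≈A_ {H = H} f (comb l)

onArcs : ∀ {n} → Graph n → ArcVec n → ArcVec n
onArcs H f u v = if adj H u v then f u v else 0ℤ

record SignatureSolution {n} (H : Graph n) : Set where
  field
    X : ArcVec n
    N : ℤ
    flow   : ∀ u → ∑ (λ v → onArcs H (λ a b → X a b - X b a) u v) ≡ 0ℤ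
    parity : ∑ (λ u → ∑ (λ v → onArcs H X u v)) - (Data.Integer.+ 2) * N ≡ 1ℤ
    signature : (λ u v → X u v - X v u) ∈θ H

Colourable : ∀ {n} → Graph n → ℕ → Set
Colourable {n} H k = Σ (Fin n → Fin k) λ c → ∀ u v → adj H u v ≡ true → c u ≢ c v

χ≥ : ∀ {n} → Graph n → ℕ → Set
χ≥ H k = ∀ m → m < k → ¬ Colourable H m

-- A proper 3-colouring c of H weights each arc (u,v) by turn (c u) (c v) ∈ {1, -1}, the
-- orientation of the edge c u — c v of the triangle.  This weighting ω is antisymmetric
-- and kills every 4-cycle generator, so it factors through 𝒢(H).  For a solution X of
-- the signature system, pairing with ω gives 2⟨X,ω⟩ = ⟨X - Xᵀ,ω⟩ = 0 by the signature
-- constraint, whereas ω being odd gives ⟨X,ω⟩ ≡ ∑ X = 1 + 2N (mod 2).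
module Submission where

open import Defs hiding (sym)
open import Defs using () renaming (sym to adj-sym)
open import Data.Bool using (true; false)
open import Data.Fin using (Fin; zero; suc; inject≤; punchIn)
open import Data.Fin.Patterns using (0F; 1F; 2F)
open import Data.Fin.Properties using (all?; inject≤-injective; punchInᵢ≢i) renaming (_≟_ to _≟ᶠ_)
open import Data.Integer using (ℤ; 0ℤ; 1ℤ; -1ℤ; _+_; _-_; _*_; -_; +_; -[1+_]; _≟_)
open import Data.Integer.Properties
  using (+-*-semiring; +-identityˡ; +-identityʳ; *-identityˡ; *-identityʳ; *-zeroʳ; *-assoc; *-distribʳ-+;
         -1*i≡-i; neg-distribˡ-*; neg-distribʳ-*; *-cancelˡ-≡)
open import Algebra.Properties.Semiring.Sum +-*-semiring
  using (sum; sum-cong-≗; sum-replicate-zero; sum-remove; ∑-distrib-+; ∑-comm; *-distribˡ-sum)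
open import Data.Integer.Tactic.RingSolver using (solve-∀)
open import Data.List using ([]; _∷_)
open import Data.Nat using (ℕ; zero; suc; _≤_; s≤s)
open import Data.Product using (_,_; proj₁; proj₂)
open import Function using (_∘_)
open import Relation.Binary.PropositionalEquality
open import Relation.Nullary using (¬_; yes; no; contradiction)
open import Relation.Nullary.Decidable using (from-yes; ¬?; _→-dec_)

open ≡-Reasoning

∑≡sum : ∀ {n} (f : Fin n → ℤ) → ∑ f ≡ sum f
∑≡sum {zero}  f = refl
∑≡sum {suc n} f = cong (_+_ (f zero)) (∑≡sum (f ∘ suc))

sum-zero : ∀ {n} (f : Fin n → ℤ) → (∀ i → f i ≡ 0ℤ) → sum f ≡ 0ℤ
sum-zero {n} f f≡0 = trans (sum-cong-≗ f≡0) (sum-replicate-zero n)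

sum-single : ∀ {n} (f : Fin n → ℤ) (a : Fin n) → (∀ i → i ≢ a → f i ≡ 0ℤ) → sum f ≡ f a
sum-single {suc n} f a f≡0 = begin
  sum f                             ≡⟨ sum-remove {i = a} f ⟩
  f a + sum (λ j → f (punchIn a j)) ≡⟨ cong (_+_ (f a)) (sum-zero _ λ j → f≡0 _ (punchInᵢ≢i a j)) ⟩
  f a + 0ℤ                          ≡⟨ +-identityʳ (f a) ⟩
  f a                               ∎

module _ {n : ℕ} where

  sum² : ArcVec n → ℤ
  sum² f = sum λ u → sum λ v → f u v

  ∑²≡sum² : (f : ArcVec n) → ∑ (λ u → ∑ (λ v → f u v)) ≡ sum² f
  ∑²≡sum² f = trans (∑≡sum (λ u → ∑ (f u))) (sum-cong-≗ λ u → ∑≡sum (f u))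

  sum²-cong : {f g : ArcVec n} → (∀ u v → f u v ≡ g u v) → sum² f ≡ sum² g
  sum²-cong f≗g = sum-cong-≗ λ u → sum-cong-≗ (f≗g u)

  sum²-zero : sum² (λ _ _ → 0ℤ) ≡ 0ℤ
  sum²-zero = sum-zero {n} _ λ u → sum-zero {n} _ λ v → refl

  sum²-+ : (f g : ArcVec n) → sum² (λ u v → f u v + g u v) ≡ sum² f + sum² g
  sum²-+ f g = trans (sum-cong-≗ λ u → ∑-distrib-+ (f u) (g u)) (∑-distrib-+ (λ u → sum (f u)) (λ u → sum (g u)))

  sum²-* : (k : ℤ) (f : ArcVec n) → sum² (λ u v → k * f u v) ≡ k * sum² f
  sum²-* k f = sym (trans (*-distribˡ-sum k (λ u → sum (f u))) (sum-cong-≗ λ u → *-distribˡ-sum k (f u)))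

  sum²-neg : (f : ArcVec n) → sum² (λ u v → - f u v) ≡ - sum² f
  sum²-neg f = begin
    sum² (λ u v → - f u v)     ≡⟨ sum²-cong (λ u v → sym (-1*i≡-i (f u v))) ⟩
    sum² (λ u v → -1ℤ * f u v) ≡⟨ sum²-* -1ℤ f ⟩
    -1ℤ * sum² f               ≡⟨ -1*i≡-i (sum² f) ⟩
    - sum² f                   ∎

  sum²-- : (f g : ArcVec n) → sum² (λ u v → f u v - g u v) ≡ sum² f - sum² g
  sum²-- f g = trans (sum²-+ f (λ u v → - g u v)) (cong (_+_ (sum² f)) (sum²-neg g))

  sum²-transpose : (f : ArcVec n) → sum² (λ u v → f v u) ≡ sum² f
  sum²-transpose f = ∑-comm (λ u v → f v u)

  sum²-single : (f : ArcVec n) (a b : Fin n) →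
                (∀ u v → (u , v) ≢ (a , b) → f u v ≡ 0ℤ) → sum² f ≡ f a b
  sum²-single f a b f≡0 =
    trans (sum-single (λ u → sum (f u)) a λ u u≢a → sum-zero (f u) λ v → f≡0 u v (u≢a ∘ cong proj₁))
          (sum-single (f a) b λ v v≢b → f≡0 a v (v≢b ∘ cong proj₂))

  δ-off : {a b p q : Fin n} → (p , q) ≢ (a , b) → δ a b p q ≡ 0ℤ
  δ-off {a} {b} {p} {q} pq≢ab with a ≟ᶠ p | b ≟ᶠ q
  ... | yes refl | yes refl = contradiction refl pq≢ab
  ... | yes _    | no _     = refl
  ... | no _     | _        = refl

  δ-diag : (a b : Fin n) → δ a b a b ≡ 1ℤ
  δ-diag a b with a ≟ᶠ a | b ≟ᶠ b
  ... | yes _  | yes _  = refl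
  ... | yes _  | no b≢b = contradiction refl b≢b
  ... | no a≢a | _      = contradiction refl a≢a

  ⟪_,_⟫ : ArcVec n → ArcVec n → ℤ
  ⟪ f , ω ⟫ = sum² λ u v → f u v * ω u v

  module _ (ω : ArcVec n) where

    ⟪⟫-+ : (f g : ArcVec n) → ⟪ (λ u v → f u v + g u v) , ω ⟫ ≡ ⟪ f , ω ⟫ + ⟪ g , ω ⟫
    ⟪⟫-+ f g = trans (sum²-cong λ u v → *-distribʳ-+ (ω u v) (f u v) (g u v)) (sum²-+ _ _)

    ⟪⟫-* : (k : ℤ) (f : ArcVec n) → ⟪ (λ u v → k * f u v) , ω ⟫ ≡ k * ⟪ f , ω ⟫
    ⟪⟫-* k f = trans (sum²-cong λ u v → *-assoc k (f u v) (ω u v)) (sum²-* k _)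

    ⟪⟫-- : (f g : ArcVec n) → ⟪ (λ u v → f u v - g u v) , ω ⟫ ≡ ⟪ f , ω ⟫ - ⟪ g , ω ⟫
    ⟪⟫-- f g = begin
      ⟪ (λ u v → f u v - g u v) , ω ⟫                ≡⟨ ⟪⟫-+ f (λ u v → - g u v) ⟩
      ⟪ f , ω ⟫ + sum² (λ u v → - g u v * ω u v)     ≡⟨ cong (_+_ ⟪ f , ω ⟫) (sum²-cong λ u v →
                                                          sym (neg-distribˡ-* (g u v) (ω u v))) ⟩
      ⟪ f , ω ⟫ + sum² (λ u v → - (g u v * ω u v))   ≡⟨ cong (_+_ ⟪ f , ω ⟫) (sum²-neg _) ⟩
      ⟪ f , ω ⟫ - ⟪ g , ω ⟫                          ∎

    ⟪⟫-transpose : (f : ArcVec n) → ⟪ (λ u v → f v u) , ω ⟫ ≡ ⟪ f , (λ u v → ω v u) ⟫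
    ⟪⟫-transpose f = sum²-transpose (λ u v → f u v * ω v u)

    ⟪δ⟫ : (a b : Fin n) → ⟪ δ a b , ω ⟫ ≡ ω a b
    ⟪δ⟫ a b = begin
      ⟪ δ a b , ω ⟫         ≡⟨ sum²-single _ a b (λ p q pq≢ab → cong (_* ω p q) (δ-off pq≢ab)) ⟩
      δ a b a b * ω a b     ≡⟨ cong (_* ω a b) (δ-diag a b) ⟩
      1ℤ * ω a b            ≡⟨ *-identityˡ (ω a b) ⟩
      ω a b                 ∎

cycleSum : ∀ {n} {H : Graph n} → ArcVec n → FourCycle H → ℤ
cycleSum ω c = ω u v - ω w v + ω w x - ω u x
  where open FourCycle c

module _ {n : ℕ} {H : Graph n} where

  ⟪gen⟫ : (ω : ArcVec n) (c : FourCycle H) → ⟪ gen c , ω ⟫ ≡ cycleSum ω c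
  ⟪gen⟫ ω c = begin
    ⟪ gen c , ω ⟫
      ≡⟨ ⟪⟫-- ω (λ p q → δ u v p q - δ w v p q + δ w x p q) (δ u x) ⟩
    ⟪ (λ p q → δ u v p q - δ w v p q + δ w x p q) , ω ⟫ - ⟪ δ u x , ω ⟫
      ≡⟨ cong (_- ⟪ δ u x , ω ⟫) (⟪⟫-+ ω (λ p q → δ u v p q - δ w v p q) (δ w x)) ⟩
    ⟪ (λ p q → δ u v p q - δ w v p q) , ω ⟫ + ⟪ δ w x , ω ⟫ - ⟪ δ u x , ω ⟫
      ≡⟨ cong (λ s → s + ⟪ δ w x , ω ⟫ - ⟪ δ u x , ω ⟫) (⟪⟫-- ω (δ u v) (δ w v)) ⟩
    ⟪ δ u v , ω ⟫ - ⟪ δ w v , ω ⟫ + ⟪ δ w x , ω ⟫ - ⟪ δ u x , ω ⟫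
      ≡⟨ cong₂ (λ s t → s + ⟪ δ w x , ω ⟫ - t) (cong₂ _-_ (⟪δ⟫ ω u v) (⟪δ⟫ ω w v)) (⟪δ⟫ ω u x) ⟩
    ω u v - ω w v + ⟪ δ w x , ω ⟫ - ω u x
      ≡⟨ cong (λ s → ω u v - ω w v + s - ω u x) (⟪δ⟫ ω w x) ⟩
    cycleSum ω c ∎
    where open FourCycle c

  ⟪comb⟫≡0 : (ω : ArcVec n) → (∀ c → cycleSum ω c ≡ 0ℤ) → ∀ l → ⟪ comb {H = H} l , ω ⟫ ≡ 0ℤ
  ⟪comb⟫≡0 ω ω-cycle []            = sum²-zero {n}
  ⟪comb⟫≡0 ω ω-cycle ((k , c) ∷ l) = begin
    ⟪ comb ((k , c) ∷ l) , ω ⟫                             ≡⟨ ⟪⟫-+ ω (λ p q → k * gen c p q) (comb l) ⟩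
    ⟪ (λ p q → k * gen c p q) , ω ⟫ + ⟪ comb l , ω ⟫       ≡⟨ cong₂ _+_ (⟪⟫-* ω k (gen c))
                                                                       (⟪comb⟫≡0 ω ω-cycle l) ⟩
    k * ⟪ gen c , ω ⟫ + 0ℤ                                 ≡⟨ cong (λ s → k * s + 0ℤ)
                                                                (trans (⟪gen⟫ ω c) (ω-cycle c)) ⟩
    k * 0ℤ + 0ℤ                                            ≡⟨ cong (_+ 0ℤ) (*-zeroʳ k) ⟩
    0ℤ                                                     ∎

  onArcs-arc : (f : ArcVec n) {u v : Fin n} → adj H u v ≡ true → onArcs H f u v ≡ f u v
  onArcs-arc f uv rewrite uv = refl

  ⟪⟫-onArcs-cong : (ω : ArcVec n) {f g : ArcVec n} → _≈A_ {H = H} f g →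
                   ⟪ f , onArcs H ω ⟫ ≡ ⟪ g , onArcs H ω ⟫
  ⟪⟫-onArcs-cong ω {f} {g} f≈g = sum²-cong pointwise
    where
    pointwise : ∀ u v → f u v * onArcs H ω u v ≡ g u v * onArcs H ω u v
    pointwise u v with adj H u v in uv
    ... | true  = cong (_* ω u v) (f≈g u v uv)
    ... | false = trans (*-zeroʳ (f u v)) (sym (*-zeroʳ (g u v)))

  cycleSum-onArcs : (ω : ArcVec n) (c : FourCycle H) → cycleSum (onArcs H ω) c ≡ cycleSum ω c
  cycleSum-onArcs ω c =
    cong₂ _-_ (cong₂ _+_ (cong₂ _-_ (onArcs-arc ω uv) (onArcs-arc ω (trans (adj-sym H w v) vw)))
                         (onArcs-arc ω wx))
              (onArcs-arc ω (trans (adj-sym H u x) xu))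
    where open FourCycle c

  ⟪⟫-θ : (ω : ArcVec n) → (∀ c → cycleSum ω c ≡ 0ℤ) →
         ∀ {f} → f ∈θ H → ⟪ f , onArcs H ω ⟫ ≡ 0ℤ
  ⟪⟫-θ ω ω-cycle (l , f≈comb) =
    trans (⟪⟫-onArcs-cong ω f≈comb)
          (⟪comb⟫≡0 (onArcs H ω) (λ c → trans (cycleSum-onArcs ω c) (ω-cycle c)) l)

-- A homomorphism 𝒢(H) → ℤ that is odd on arcs, given by its values on the arcs.
record OddWeighting {n : ℕ} (H : Graph n) : Set where
  field
    weight         : ArcVec n
    deficit        : ArcVec n
    weight-antisym : ∀ u v → adj H u v ≡ true → weight v u ≡ - weight u v
    weight-odd     : ∀ u v → adj H u v ≡ true → weight u v + + 2 * deficit u v ≡ 1ℤ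
    weight-cycle   : (c : FourCycle H) → cycleSum weight c ≡ 0ℤ

2*i≢1 : ∀ i → + 2 * i ≢ 1ℤ
2*i≢1 (+ 0)           ()
2*i≢1 (+ 1)           ()
2*i≢1 (+ suc (suc _)) ()
2*i≢1 -[1+ _ ]        ()

module _ {n : ℕ} {H : Graph n} (Ω : OddWeighting H) where
  open OddWeighting Ω

  ψ : ArcVec n → ℤ
  ψ f = ⟪ f , onArcs H weight ⟫

  onArcs-weight-antisym : ∀ u v → onArcs H weight v u ≡ - onArcs H weight u v
  onArcs-weight-antisym u v rewrite adj-sym H v u with adj H u v in uv
  ... | true  = weight-antisym u v uv
  ... | false = refl

  ψ-transpose : (f : ArcVec n) → ψ (λ u v → f v u) ≡ - ψ f
  ψ-transpose f = begin
    ψ (λ u v → f v u)                             ≡⟨ ⟪⟫-transpose _ f ⟩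
    sum² (λ u v → f u v * onArcs H weight v u)    ≡⟨ sum²-cong (λ u v → trans
        (cong (f u v *_) (onArcs-weight-antisym u v)) (sym (neg-distribʳ-* (f u v) (onArcs H weight u v)))) ⟩
    sum² (λ u v → - (f u v * onArcs H weight u v)) ≡⟨ sum²-neg (λ u v → f u v * onArcs H weight u v) ⟩
    - ψ f                                         ∎

  ψ-antisymmetrisation : (f : ArcVec n) → ψ (λ u v → f u v - f v u) ≡ + 2 * ψ f
  ψ-antisymmetrisation f = begin
    ψ (λ u v → f u v - f v u) ≡⟨ ⟪⟫-- _ f (λ u v → f v u) ⟩
    ψ f - ψ (λ u v → f v u)   ≡⟨ cong (_-_ (ψ f)) (ψ-transpose f) ⟩
    ψ f - - ψ f               ≡⟨ double (ψ f) ⟩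
    + 2 * ψ f                 ∎
    where
    double : ∀ s → s - - s ≡ + 2 * s
    double = solve-∀

  arcSum≡ψ+2* : (f : ArcVec n) →
    sum² (onArcs H f) ≡ ψ f + + 2 * sum² (onArcs H (λ u v → deficit u v * f u v))
  arcSum≡ψ+2* f = trans (sum²-cong pointwise)
    (trans (sum²-+ (λ u v → f u v * onArcs H weight u v) (λ u v → + 2 * onArcs H fd u v))
           (cong (_+_ (ψ f)) (sum²-* (+ 2) (onArcs H fd))))
    where
    fd : ArcVec n
    fd u v = deficit u v * f u v
    expand : ∀ x w d → x * (w + + 2 * d) ≡ x * w + + 2 * (d * x)
    expand = solve-∀
    pointwise : ∀ u v → onArcs H f u v ≡
      f u v * onArcs H weight u v + + 2 * onArcs H fd u v
    pointwise u v with adj H u v in uv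
    ... | true  = begin
      f u v                                  ≡⟨ *-identityʳ (f u v) ⟨
      f u v * 1ℤ                             ≡⟨ cong (f u v *_) (weight-odd u v uv) ⟨
      f u v * (weight u v + + 2 * deficit u v) ≡⟨ expand (f u v) (weight u v) (deficit u v) ⟩
      f u v * weight u v + + 2 * (deficit u v * f u v) ∎
    ... | false = sym (cong (_+ 0ℤ) (*-zeroʳ (f u v)))

  no-signature-solution : ¬ SignatureSolution H
  no-signature-solution sol = 2*i≢1 (K - N) (begin
    + 2 * (K - N)                                 ≡⟨ distrib K N ⟩
    + 2 * K - + 2 * N                             ≡⟨ cong (_- + 2 * N) arcSum≡2K ⟨
    ∑ (λ u → ∑ (λ v → onArcs H X u v)) - + 2 * N  ≡⟨ parity ⟩
    1ℤ                                            ∎)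
    where
    open SignatureSolution sol
    K : ℤ
    K = sum² (onArcs H (λ u v → deficit u v * X u v))
    distrib : ∀ a b → + 2 * (a - b) ≡ + 2 * a - + 2 * b
    distrib = solve-∀
    ψX≡0 : ψ X ≡ 0ℤ
    ψX≡0 = *-cancelˡ-≡ (+ 2) (ψ X) 0ℤ
             (trans (sym (ψ-antisymmetrisation X)) (⟪⟫-θ weight weight-cycle signature))
    arcSum≡2K : ∑ (λ u → ∑ (λ v → onArcs H X u v)) ≡ + 2 * K
    arcSum≡2K = begin
      ∑ (λ u → ∑ (λ v → onArcs H X u v)) ≡⟨ ∑²≡sum² (onArcs H X) ⟩
      sum² (onArcs H X)                  ≡⟨ arcSum≡ψ+2* X ⟩
      ψ X + + 2 * K                      ≡⟨ cong (_+ + 2 * K) ψX≡0 ⟩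
      0ℤ + + 2 * K                       ≡⟨ +-identityˡ (+ 2 * K) ⟩
      + 2 * K                            ∎

turn : Fin 3 → Fin 3 → ℤ
turn 0F 1F = 1ℤ
turn 1F 2F = 1ℤ
turn 2F 0F = 1ℤ
turn 1F 0F = -1ℤ
turn 2F 1F = -1ℤ
turn 0F 2F = -1ℤ
turn _  _  = 0ℤ

turnDeficit : Fin 3 → Fin 3 → ℤ
turnDeficit 1F 0F = 1ℤ
turnDeficit 2F 1F = 1ℤ
turnDeficit 0F 2F = 1ℤ
turnDeficit _  _  = 0ℤ

turn-antisym : ∀ a b → turn b a ≡ - turn a b
turn-antisym = from-yes (all? λ a → all? λ b → turn b a ≟ - turn a b)

turn-odd : ∀ a b → a ≢ b → turn a b + + 2 * turnDeficit a b ≡ 1ℤ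
turn-odd = from-yes (all? λ a → all? λ b →
  ¬? (a ≟ᶠ b) →-dec (turn a b + + 2 * turnDeficit a b ≟ 1ℤ))

-- turn a b ≡ b - a (mod 3), so the sum is a multiple of 3 in {-4,-2,0,2,4}.
turn-square : ∀ a b c d → a ≢ b → c ≢ b → c ≢ d → a ≢ d →
              turn a b - turn c b + turn c d - turn a d ≡ 0ℤ
turn-square = from-yes (all? λ a → all? λ b → all? λ c → all? λ d →
  ¬? (a ≟ᶠ b) →-dec ¬? (c ≟ᶠ b) →-dec ¬? (c ≟ᶠ d) →-dec ¬? (a ≟ᶠ d) →-dec
  (turn a b - turn c b + turn c d - turn a d ≟ 0ℤ))

colouring⇒oddWeighting : ∀ {n} {H : Graph n} → Colourable H 3 → OddWeighting H
colouring⇒oddWeighting {H = H} (col , proper) = record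
  { weight         = λ u v → turn (col u) (col v)
  ; deficit        = λ u v → turnDeficit (col u) (col v)
  ; weight-antisym = λ u v _ → turn-antisym (col u) (col v)
  ; weight-odd     = λ u v uv → turn-odd (col u) (col v) (proper u v uv)
  ; weight-cycle   = square
  }
  where
  square : ∀ c → cycleSum (λ u v → turn (col u) (col v)) c ≡ 0ℤ
  square c = turn-square (col u) (col v) (col w) (col x)
    (proper u v uv) (proper w v (trans (adj-sym H w v) vw)) (proper w x wx)
    (proper u x (trans (adj-sym H u x) xu))
    where open FourCycle c

Colourable-mono : ∀ {n m k} {H : Graph n} → m ≤ k → Colourable H m → Colourable H k
Colourable-mono m≤k (col , proper) =
  (λ u → inject≤ (col u) m≤k) , λ u v uv eq → proper u v uv (inject≤-injective m≤k m≤k _ _ eq)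

proposition10 : ∀ (n : ℕ) (H : Graph n) → SignatureSolution H → χ≥ H 4
proposition10 n H sol m (s≤s m≤3) col =
  no-signature-solution (colouring⇒oddWeighting (Colourable-mono {H = H} m≤3 col)) sol
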